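{- Let $k\leq s\leq n$ be natural numbers and suppose $\mathcal{F}\subseteq\binom{[n]}{s}$ has VC-dimension $m$ and the $k$-covering property (as a family of subsets of $[n]$). Then there is a family $\mathcal{F}_*\subseteq\binom{[n+1]}{s+1}$ of VC-dimension $m$ with the $k$-covering property (as a family of subsets of $[n+1]$); in fact $\mathcal{F}_*$ shatters exactly the same sets as $\mathcal{F}$. In particular, for every $k\leq s\leq n$ we have $D(k,s+1,n+1)\leq D(k,s,n)$.
   Context: For a natural number $n$, $[n]=\{1,\dots,n\}$, and for a set $A$ and $s\in\mathbb{N}$, $\binom{A}{s}$ denotes the set of $s$-element subsets of $A$. A set $A$ is shattered by a family $\mathcal{F}$ of sets if $\{A\cap S: S\in\mathcal{F}\}=2^A$. The VC-dimension of $\mathcal{F}$ is the size of the largest finite set shattered by $\mathcal{F}$. A family $\mathcal{F}\subseteq 2^X$ has the $k$-covering property if every $k$-element subset of $X$ is contained in some member of $\mathcal{F}$. For natural numbers $k\leq s\leq n$, $D(k,s,n)$ denotes the smallest VC-dimension of a family $\mathcal{F}\subseteq\binom{[n]}{s}$ having the $k$-covering property (as subsets of $[n]$). -}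

module Defs where

open import Data.Nat using (ℕ; suc; _≤_)
open import Data.Bool using (false)
open import Data.Vec using (_∷ʳ_)
open import Data.Fin.Subset using (Subset; _⊆_; _∩_; ∣_∣)
open import Data.Product using (Σ; _×_)
open import Relation.Binary.PropositionalEquality using (_≡_)

Family : ℕ → Set₁
Family n = Subset n → Set

Shatters : ∀ {n} → Family n → Subset n → Set
Shatters {n} F A = (B : Subset n) → B ⊆ A → Σ (Subset n) λ S → F S × (A ∩ S ≡ B)

HasVCdim : ∀ {n} → Family n → ℕ → Set
HasVCdim {n} F m =
  (Σ (Subset n) λ A → Shatters F A × (∣ A ∣ ≡ m)) ×
  ((A : Subset n) → Shatters F A → ∣ A ∣ ≤ m)

Uniform : ∀ {n} → Family n → ℕ → Set
Uniform {n} F s = (S : Subset n) → F S → ∣ S ∣ ≡ s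

Covering : ∀ {n} → ℕ → Family n → Set
Covering {n} k F = (K : Subset n) → ∣ K ∣ ≡ k → Σ (Subset n) λ S → F S × (K ⊆ S)

embed : ∀ {n} → Subset n → Subset (suc n)
embed A = A ∷ʳ false

IsD : ℕ → ℕ → ℕ → ℕ → Set₁
IsD k s n d =
  (Σ (Family n) λ F → Uniform F s × Covering k F × HasVCdim F d) ×
  ((F : Family n) → Uniform F s → Covering k F → (m : ℕ) → HasVCdim F m → d ≤ m)

{-# OPTIONS --safe #-}
-- Adjoin a new point n+1 to every member of F.  A k-set K
-- is still covered: K without n+1 extends to a k-subset of [n] (as k ≤ n), which
-- lies in some S ∈ F, and then K ⊆ S ∪ {n+1}.  Since every member contains n+1,
-- the empty trace is impossible on a set containing n+1, so shattered sets avoid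
-- n+1, and on such sets the traces are exactly those of F.
module Submission where

open import Defs
open import Data.Nat using (ℕ; zero; suc; _≤_; z≤n; s≤s)
open import Data.Nat.Properties using (≤-trans; ≤-reflexive; m≤n⇒m<n∨m≡n)
open import Data.Bool using (Bool; _∧_; f≤t; b≤b)
import Data.Bool as Bool
open import Data.Bool.Properties using (∧-identityʳ; ≤-maximum)
open import Data.Vec using ([]; _∷_; _∷ʳ_; initLast; here)
open import Data.Vec.Properties using (∷ʳ-injectiveˡ; ∷ʳ-injectiveʳ)
open import Data.Fin.Subset using (Subset; _⊆_; _∩_; ∣_∣; ⊥; ⊤; inside; outside)
open import Data.Fin.Subset.Properties
  using (⊥⊆; ⊆⊤; out⊆; in⊆in; drop-∷-⊆; ∣p∣≤∣x∷p∣; ∣⊤∣≡n)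
open import Data.Sum using (inj₁; inj₂)
open import Data.Product using (Σ; ∃; _×_; _,_; map₁)
open import Function.Bundles using (_⇔_; mk⇔; module Equivalence)
open import Function.Base using (_∘_)
open import Relation.Binary.PropositionalEquality using (_≡_; refl; sym; trans; cong)
open import Relation.Nullary using (contradiction)

private
  variable
    n : ℕ

∷ʳ-⊆ : {p q : Subset n} {b c : Bool} → p ⊆ q → b Bool.≤ c → p ∷ʳ b ⊆ q ∷ʳ c
∷ʳ-⊆ {p = []}          {q = []}          _ b≤b = λ x∈ → x∈
∷ʳ-⊆ {p = []}          {q = []}          _ f≤t = out⊆ ⊥⊆
∷ʳ-⊆ {p = outside ∷ p} {q = _ ∷ q}       h b≤c = out⊆ (∷ʳ-⊆ (drop-∷-⊆ h) b≤c)
∷ʳ-⊆ {p = inside ∷ p}  {q = inside ∷ q}  h b≤c = in⊆in (∷ʳ-⊆ (drop-∷-⊆ h) b≤c)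
∷ʳ-⊆ {p = inside ∷ p}  {q = outside ∷ q} h _   = contradiction (h here) λ ()

∷ʳ-⊆⁻ : {p q : Subset n} {b c : Bool} → p ∷ʳ b ⊆ q ∷ʳ c → p ⊆ q × b Bool.≤ c
∷ʳ-⊆⁻ {p = []} {q = []} {b = outside} {c = outside} _ = ⊥⊆ , b≤b
∷ʳ-⊆⁻ {p = []} {q = []} {b = outside} {c = inside}  _ = ⊥⊆ , f≤t
∷ʳ-⊆⁻ {p = []} {q = []} {b = inside}                h with h here
... | here = ⊥⊆ , b≤b
∷ʳ-⊆⁻ {p = outside ∷ p} {q = _ ∷ q}       h = map₁ out⊆ (∷ʳ-⊆⁻ (drop-∷-⊆ h))
∷ʳ-⊆⁻ {p = inside ∷ p}  {q = inside ∷ q}  h = map₁ in⊆in (∷ʳ-⊆⁻ (drop-∷-⊆ h))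
∷ʳ-⊆⁻ {p = inside ∷ p}  {q = outside ∷ q} h = contradiction (h here) λ ()

∩-∷ʳ : (p q : Subset n) (a b : Bool) → (p ∷ʳ a) ∩ (q ∷ʳ b) ≡ (p ∩ q) ∷ʳ (a ∧ b)
∩-∷ʳ []      []      a b = refl
∩-∷ʳ (x ∷ p) (y ∷ q) a b = cong (x ∧ y ∷_) (∩-∷ʳ p q a b)

⊥-∷ʳ : ∀ n → ⊥ {suc n} ≡ ⊥ {n} ∷ʳ outside
⊥-∷ʳ zero    = refl
⊥-∷ʳ (suc n) = cong (outside ∷_) (⊥-∷ʳ n)

∣p∷ʳx∣≡∣x∷p∣ : ∀ x (p : Subset n) → ∣ p ∷ʳ x ∣ ≡ ∣ x ∷ p ∣
∣p∷ʳx∣≡∣x∷p∣ outside []           = refl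
∣p∷ʳx∣≡∣x∷p∣ inside  []           = refl
∣p∷ʳx∣≡∣x∷p∣ outside (outside ∷ p) = ∣p∷ʳx∣≡∣x∷p∣ outside p
∣p∷ʳx∣≡∣x∷p∣ inside  (outside ∷ p) = ∣p∷ʳx∣≡∣x∷p∣ inside p
∣p∷ʳx∣≡∣x∷p∣ outside (inside ∷ p)  = cong suc (∣p∷ʳx∣≡∣x∷p∣ outside p)
∣p∷ʳx∣≡∣x∷p∣ inside  (inside ∷ p)  = cong suc (∣p∷ʳx∣≡∣x∷p∣ inside p)

⊆-extendToSize : ∀ (p : Subset n) {j} → ∣ p ∣ ≤ j → j ≤ n → ∃ λ q → p ⊆ q × ∣ q ∣ ≡ j
⊆-extendToSize []            z≤n        z≤n = [] , (λ x∈ → x∈) , refl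
⊆-extendToSize (inside ∷ p)  (s≤s ∣p∣≤j) (s≤s j≤n) =
  let q , p⊆q , ∣q∣≡j = ⊆-extendToSize p ∣p∣≤j j≤n in inside ∷ q , in⊆in p⊆q , cong suc ∣q∣≡j
⊆-extendToSize {suc n} (outside ∷ p) ∣p∣≤j j≤1+n with m≤n⇒m<n∨m≡n j≤1+n
... | inj₁ (s≤s j≤n) =
  let q , p⊆q , ∣q∣≡j = ⊆-extendToSize p ∣p∣≤j j≤n in outside ∷ q , out⊆ p⊆q , ∣q∣≡j
... | inj₂ refl = ⊤ , ⊆⊤ , ∣⊤∣≡n (suc n)

withNewPoint : Family n → Family (suc n)
withNewPoint F S = ∃ λ S₀ → F S₀ × S ≡ S₀ ∷ʳ inside

module _ {n} (F : Family n) where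

  withNewPoint-uniform : ∀ {s} → Uniform F s → Uniform (withNewPoint F) (suc s)
  withNewPoint-uniform uniform _ (S₀ , S₀∈F , refl) =
    trans (∣p∷ʳx∣≡∣x∷p∣ inside S₀) (cong suc (uniform S₀ S₀∈F))

  withNewPoint-covering : ∀ {k} → k ≤ n → Covering k F → Covering k (withNewPoint F)
  withNewPoint-covering {k} k≤n covering K ∣K∣≡k with initLast K
  ... | K₀ , x , refl =
    let Y , K₀⊆Y , ∣Y∣≡k = ⊆-extendToSize K₀ ∣K₀∣≤k k≤n
        S₀ , S₀∈F , Y⊆S₀ = covering Y ∣Y∣≡k
    in S₀ ∷ʳ inside , (S₀ , S₀∈F , refl) , ∷ʳ-⊆ (Y⊆S₀ ∘ K₀⊆Y) (≤-maximum x)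
    where
    ∣K₀∣≤k : ∣ K₀ ∣ ≤ k
    ∣K₀∣≤k = ≤-trans (∣p∣≤∣x∷p∣ x K₀) (≤-reflexive (trans (sym (∣p∷ʳx∣≡∣x∷p∣ x K₀)) ∣K∣≡k))

  shatters-embed⇔ : ∀ {A₀} → Shatters F A₀ ⇔ Shatters (withNewPoint F) (embed A₀)
  shatters-embed⇔ {A₀} = mk⇔ to from
    where
    to : Shatters F A₀ → Shatters (withNewPoint F) (embed A₀)
    to shatters B B⊆A with initLast B
    ... | B₀ , b , refl with ∷ʳ-⊆⁻ B⊆A
    ... | B₀⊆A₀ , b≤b =
      let S₀ , S₀∈F , A₀∩S₀≡B₀ = shatters B₀ B₀⊆A₀
      in S₀ ∷ʳ inside , (S₀ , S₀∈F , refl) ,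
         trans (∩-∷ʳ A₀ S₀ outside inside) (cong (_∷ʳ outside) A₀∩S₀≡B₀)
    from : Shatters (withNewPoint F) (embed A₀) → Shatters F A₀
    from shatters B₀ B₀⊆A₀ with shatters (embed B₀) (∷ʳ-⊆ B₀⊆A₀ b≤b)
    ... | _ , (S₀ , S₀∈F , refl) , trace≡B =
      S₀ , S₀∈F , ∷ʳ-injectiveˡ _ _ (trans (sym (∩-∷ʳ A₀ S₀ outside inside)) trace≡B)

  withNewPoint-shattered⇒embedded :
    ∀ A → Shatters (withNewPoint F) A → ∃ λ A₀ → A ≡ embed A₀
  withNewPoint-shattered⇒embedded A shatters with initLast A
  ... | A₀ , a , refl with shatters ⊥ ⊥⊆
  ... | _ , (S₀ , _ , refl) , trace≡⊥ =
    A₀ , cong (A₀ ∷ʳ_) (trans (sym (∧-identityʳ a)) a∧inside≡outside)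
    where
    a∧inside≡outside : a ∧ inside ≡ outside
    a∧inside≡outside =
      ∷ʳ-injectiveʳ (A₀ ∩ S₀) ⊥ (trans (sym (∩-∷ʳ A₀ S₀ a inside)) (trans trace≡⊥ (⊥-∷ʳ n)))

  withNewPoint-shatters⇔ : ∀ A →
    Shatters (withNewPoint F) A ⇔ (Σ (Subset n) λ A₀ → (A ≡ embed A₀) × Shatters F A₀)
  withNewPoint-shatters⇔ A = mk⇔ to from
    where
    to : Shatters (withNewPoint F) A → Σ (Subset n) λ A₀ → (A ≡ embed A₀) × Shatters F A₀
    to shatters with withNewPoint-shattered⇒embedded A shatters
    ... | A₀ , refl = A₀ , refl , Equivalence.from shatters-embed⇔ shatters
    from : (Σ (Subset n) λ A₀ → (A ≡ embed A₀) × Shatters F A₀) → Shatters (withNewPoint F) A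
    from (A₀ , refl , shatters) = Equivalence.to shatters-embed⇔ shatters

  withNewPoint-hasVCdim : ∀ {m} → HasVCdim F m → HasVCdim (withNewPoint F) m
  withNewPoint-hasVCdim {m} ((A , shatters , ∣A∣≡m) , maximal) =
    (embed A , Equivalence.to shatters-embed⇔ shatters , trans (∣p∷ʳx∣≡∣x∷p∣ outside A) ∣A∣≡m) ,
    maximal⁺
    where
    maximal⁺ : ∀ A′ → Shatters (withNewPoint F) A′ → ∣ A′ ∣ ≤ m
    maximal⁺ A′ shatters′ with Equivalence.to (withNewPoint-shatters⇔ A′) shatters′
    ... | A₀ , refl , shatters₀ =
      ≤-trans (≤-reflexive (∣p∷ʳx∣≡∣x∷p∣ outside A₀)) (maximal A₀ shatters₀)

D-suc-suc-≤ : ∀ {k s n d d′} → k ≤ n → IsD k s n d → IsD k (suc s) (suc n) d′ → d′ ≤ d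
D-suc-suc-≤ k≤n ((F , uniform , covering , vcdim) , _) (_ , minimal) =
  minimal (withNewPoint F) (withNewPoint-uniform F uniform)
    (withNewPoint-covering F k≤n covering) _ (withNewPoint-hasVCdim F vcdim)

mainTheorem4 :
    ((k s n : ℕ) → k ≤ s → s ≤ n → (F : Family n) → Uniform F s → Covering k F →
      (m : ℕ) → HasVCdim F m →
      Σ (Family (suc n)) λ F* →
        Uniform F* (suc s) × Covering k F* × HasVCdim F* m ×
        ((A : Subset (suc n)) →
          Shatters F* A ⇔ (Σ (Subset n) λ A₀ → (A ≡ embed A₀) × Shatters F A₀)))
    ×
    ((k s n : ℕ) → k ≤ s → s ≤ n → (d d′ : ℕ) →
      IsD k s n d → IsD k (suc s) (suc n) d′ → d′ ≤ d)
mainTheorem4 =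
  (λ k s n k≤s s≤n F uniform covering m vcdim →
    withNewPoint F , withNewPoint-uniform F uniform ,
    withNewPoint-covering F (≤-trans k≤s s≤n) covering ,
    withNewPoint-hasVCdim F vcdim , withNewPoint-shatters⇔ F) ,
  (λ k s n k≤s s≤n d d′ → D-suc-suc-≤ (≤-trans k≤s s≤n))
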